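{- For $\Delta\in\{2,\dots,7\}$, \[ \tau_3(S_\Delta)=\tau_3(T_\Delta)=\begin{cases}8 & \Delta=2,\\ 9 & 3\le\Delta\le 4,\\ 10 & 5\le \Delta\le 7.\end{cases} \]
   Context: $S_k$ is the star with $k$ leaves (one center adjacent to $k$ leaves), and $T_k$ is the infinite $k$-regular tree. For an integer $t\ge1$, a $t$-tone coloring of a (possibly infinite) graph $G$ assigns to each vertex $v$ a set $f(v)$ of exactly $t$ colors from a color set $C$ such that $|f(u)\cap f(v)|<d(u,v)$ for all distinct $u,v$, where $d$ is graph distance; $\tau_t(G)$ is the minimum $|C|$ over all such colorings. -}

module Defs where

open import Data.Nat using (ℕ; zero; suc; _≤_; pred)
open import Data.Fin using (Fin)
open import Data.Fin.Subset using (Subset; _∩_; ∣_∣)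
open import Data.Maybe using (Maybe; just; nothing)
open import Data.List using (List; []; _∷_)
open import Data.Product using (Σ; _×_; _,_)
open import Relation.Binary.PropositionalEquality using (_≡_; _≢_)
open import Relation.Nullary using (¬_)

record Graph : Set₁ where
  field
    V   : Set
    Adj : V → V → Set
open Graph public

data Walk (G : Graph) : V G → V G → ℕ → Set where
  here : ∀ {u} → Walk G u u 0
  step : ∀ {u w v k} → Adj G u w → Walk G w v k → Walk G u v (suc k)

-- d(u,v) > m  :⇔  there is no walk of length ≤ m from u to v
-- (this covers d = ∞ for vertices in different components).
DistGreater : (G : Graph) → V G → V G → ℕ → Set
DistGreater G u v m = ∀ k → k ≤ m → ¬ Walk G u v k

ToneColoring : Graph → ℕ → ℕ → Set
ToneColoring G t n =
  Σ (V G → Subset n) λ f →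
    (∀ v → ∣ f v ∣ ≡ t) ×
    (∀ u v → u ≢ v → DistGreater G u v ∣ f u ∩ f v ∣)

ToneNumberIs : Graph → ℕ → ℕ → Set
ToneNumberIs G t n = ToneColoring G t n × (∀ m → ToneColoring G t m → n ≤ m)

data StarAdj (k : ℕ) : Maybe (Fin k) → Maybe (Fin k) → Set where
  c-l : ∀ i → StarAdj k nothing (just i)
  l-c : ∀ i → StarAdj k (just i) nothing

Star : ℕ → Graph
Star k = record { V = Maybe (Fin k) ; Adj = StarAdj k }

-- The infinite k-regular tree T_k (k ≥ 1): the root is nothing; a non-root
-- vertex is just (i , w): first step i : Fin k from the root, followed by the
-- further child choices w (most recent first), each among k - 1 children.
TreeV : ℕ → Set
TreeV k = Maybe (Fin k × List (Fin (pred k)))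

data TreeAdj (k : ℕ) : TreeV k → TreeV k → Set where
  root-down : ∀ i → TreeAdj k nothing (just (i , []))
  root-up   : ∀ i → TreeAdj k (just (i , [])) nothing
  down      : ∀ i w j → TreeAdj k (just (i , w)) (just (i , j ∷ w))
  up        : ∀ i w j → TreeAdj k (just (i , j ∷ w)) (just (i , w))

Tree : ℕ → Graph
Tree k = record { V = TreeV k ; Adj = TreeAdj k }

-- Lower bounds come from stars. In a 3-tone colouring of S_k the k leaf sets
-- avoid the three colours of the centre and pairwise share at most one colour.
-- A colour lying in s leaf sets satisfies l s ≤ C(l+1,2) + C(s,2) for every
-- weight l, so summing over the m - 3 colours left by the centre gives
-- 3 l k ≤ C(l+1,2) (m - 3) + C(k,2): with l = 1 this forces m ≥ 8, 9 for
-- k = 2, 3, and with l = 2 it forces m ≥ 10 for k = 5.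
--
-- Upper bounds come from trees. Fix a base triple B of colours and
-- involutions e_1, ..., e_K of the colours whose lines e_i(B) avoid B and
-- pairwise meet in exactly one colour. Label the edges of T_K so that every
-- vertex sees each label once, and give a vertex the image of B under the
-- composite of the involutions along its path from the root. The neighbours of
-- x then receive the images of the lines under the map of x, so adjacent sets
-- are disjoint, sets at distance 2 share one colour and sets at distance 3
-- share at most 3 - 1 = 2. Finally S_K ⊆ T_K, T_K ⊆ T_K' and S_k ⊆ S_k' for
-- k ≤ k', so the bounds for Δ = 2, 4, 7 (upper) and 2, 3, 5 (lower) suffice.

module Submission where

open import Data.Bool using (Bool; true; false; _∧_)
open import Data.Empty using (⊥-elim)
open import Data.Fin using (Fin; zero; suc; _↑ˡ_; punchIn; #_)
open import Data.Fin.Patterns using (0F; 1F; 2F)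
open import Data.Fin.Permutation as Perm using (Permutation; _⟨$⟩ʳ_; _∘ₚ_; permutation)
open import Data.Fin.Permutation.Components using (transpose)
import Data.Fin.Properties as Fin
open import Data.Fin.Properties using (all?; punchInᵢ≢i; punchIn-injective)
open import Data.Fin.Subset using (Subset; inside; ⊥; _∩_; ∁; ∣_∣; _∈_; _⊆_)
open import Data.Fin.Subset.Properties
  using (_∈?_; x∈p∩q⁺; x∉p⇒x∈∁p; x∈⁅y⁆⇒x≡y; p⊆q⇒∣p∣≤∣q∣; ∣⁅x⁆∣≡1; ∣⊥∣≡0; ∣∁p∣≡n∸∣p∣; ∣p∩q∣≤∣p∣)
open import Data.List as List using (List; []; _∷_)
import Data.List.Properties as List
open import Data.Maybe as Maybe using (just; nothing)
open import Data.Maybe.Properties using (just-injective)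
open import Data.Nat using (ℕ; zero; suc; _+_; _*_; _∸_; _≤_; _<_; z≤n; s≤s)
open import Data.Nat.Combinatorics using (_C_; nC1≡n; nCk+nC[k+1]≡[n+1]C[k+1])
open import Data.Nat.Properties
open import Algebra.Properties.Semiring.Sum +-*-semiring
  using (sum; sum-syntax; ∑-comm; ∑-distrib-+; sum-cong-≗; sum-permute; sum-replicate-zero; *-distribˡ-sum)
open import Data.Nat.Solver using (module +-*-Solver)
open import Data.Product using (_×_; _,_; proj₁)
open import Data.Product.Properties using (×-≡,≡←≡)
open import Data.Sum using (_⊎_; inj₁; inj₂)
open import Data.Vec using (Vec; []; _∷_; lookup; tabulate)
open import Data.Vec.Properties
  using (lookup-zipWith; []=⇒lookup; lookup⇒[]=; lookup∘tabulate; tabulate∘lookup; tabulate-cong)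
open import Defs
open import Function using (_∘_; case_of_)
open import Relation.Binary.PropositionalEquality
open import Relation.Nullary using (yes; no; ¬?)
open import Relation.Nullary.Decidable using (True; toWitness; _→-dec_)

bit : Bool → ℕ
bit true  = 1
bit false = 0

∑-const : ∀ k c → ∑[ i < k ] c ≡ k * c
∑-const zero    c = refl
∑-const (suc k) c = cong (c +_) (∑-const k c)

∑-mono-≤ : ∀ {k} {g h : Fin k → ℕ} → (∀ i → g i ≤ h i) → sum g ≤ sum h
∑-mono-≤ {zero}  g≤h = z≤n
∑-mono-≤ {suc k} g≤h = +-mono-≤ (g≤h zero) (∑-mono-≤ (g≤h ∘ suc))

∣p∣≡∑ : ∀ {n} (p : Subset n) → ∣ p ∣ ≡ ∑[ x < n ] bit (lookup p x)
∣p∣≡∑ []          = refl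
∣p∣≡∑ (true ∷ p)  = cong suc (∣p∣≡∑ p)
∣p∣≡∑ (false ∷ p) = ∣p∣≡∑ p

∣p∩q∣≡∑ : ∀ {n} (p q : Subset n) → ∣ p ∩ q ∣ ≡ ∑[ x < n ] bit (lookup p x ∧ lookup q x)
∣p∩q∣≡∑ p q = trans (∣p∣≡∑ (p ∩ q)) (sum-cong-≗ λ x → cong bit (lookup-zipWith _∧_ x p q))

x∈p⇒0<∣p∣ : ∀ {n x} {p : Subset n} → x ∈ p → 0 < ∣ p ∣
x∈p⇒0<∣p∣ {x = x} x∈p = subst (_≤ _) (∣⁅x⁆∣≡1 x)
  (p⊆q⇒∣p∣≤∣q∣ λ y∈⁅x⁆ → subst (_∈ _) (sym (x∈⁅y⁆⇒x≡y x y∈⁅x⁆)) x∈p)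

∣p∩q∣≡0⇒q⊆∁p : ∀ {n} {p q : Subset n} → ∣ p ∩ q ∣ ≡ 0 → q ⊆ ∁ p
∣p∩q∣≡0⇒q⊆∁p {p = p} ∣p∩q∣≡0 {x} x∈q with x ∈? p
... | yes x∈p = ⊥-elim (<⇒≢ (x∈p⇒0<∣p∣ (x∈p∩q⁺ (x∈p , x∈q))) (sym ∣p∩q∣≡0))
... | no  x∉p = x∉p⇒x∈∁p x∉p

∣p∩q∣+∣p∩r∣≤∣p∣+∣q∩r∣ : ∀ {n} (p q r : Subset n) → ∣ p ∩ q ∣ + ∣ p ∩ r ∣ ≤ ∣ p ∣ + ∣ q ∩ r ∣
∣p∩q∣+∣p∩r∣≤∣p∣+∣q∩r∣ {n} p q r = begin
  ∣ p ∩ q ∣ + ∣ p ∩ r ∣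
    ≡⟨ trans (cong₂ _+_ (∣p∩q∣≡∑ p q) (∣p∩q∣≡∑ p r)) (sym (∑-distrib-+ (λ x → bit (P x ∧ Q x)) (λ x → bit (P x ∧ R x)))) ⟩
  ∑[ x < n ] (bit (P x ∧ Q x) + bit (P x ∧ R x))
    ≤⟨ ∑-mono-≤ (λ x → bit-bound (P x) (Q x) (R x)) ⟩
  ∑[ x < n ] (bit (P x) + bit (Q x ∧ R x))
    ≡⟨ trans (∑-distrib-+ (λ x → bit (P x)) (λ x → bit (Q x ∧ R x))) (sym (cong₂ _+_ (∣p∣≡∑ p) (∣p∩q∣≡∑ q r))) ⟩
  ∣ p ∣ + ∣ q ∩ r ∣ ∎
  where
  open ≤-Reasoning
  P = lookup p
  Q = lookup q
  R = lookup r
  bit-bound : ∀ a b c → bit (a ∧ b) + bit (a ∧ c) ≤ bit a + bit (b ∧ c)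
  bit-bound false b     c     = z≤n
  bit-bound true  true  c     = ≤-refl
  bit-bound true  false true  = ≤-refl
  bit-bound true  false false = z≤n

sumPairs : ∀ {k} → (Fin k → Fin k → ℕ) → ℕ
sumPairs {zero}  w = 0
sumPairs {suc k} w = ∑[ j < k ] w zero (suc j) + sumPairs (λ i j → w (suc i) (suc j))

sumPairs-cong : ∀ {k} {w v : Fin k → Fin k → ℕ} → (∀ i j → w i j ≡ v i j) → sumPairs w ≡ sumPairs v
sumPairs-cong {zero}  w≡v = refl
sumPairs-cong {suc k} w≡v =
  cong₂ _+_ (sum-cong-≗ (w≡v zero ∘ suc)) (sumPairs-cong λ i j → w≡v (suc i) (suc j))

sumPairs-∑-comm : ∀ {k n} (w : Fin n → Fin k → Fin k → ℕ) →
  sumPairs (λ i j → ∑[ x < n ] w x i j) ≡ ∑[ x < n ] sumPairs (w x)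
sumPairs-∑-comm {zero}  {n} w = sym (sum-replicate-zero n)
sumPairs-∑-comm {suc k} {n} w = begin
  ∑[ j < k ] ∑[ x < n ] w x zero (suc j) + sumPairs (λ i j → ∑[ x < n ] w x (suc i) (suc j))
    ≡⟨ cong₂ _+_ (∑-comm (λ j x → w x zero (suc j))) (sumPairs-∑-comm (λ x i j → w x (suc i) (suc j))) ⟩
  ∑[ x < n ] ∑[ j < k ] w x zero (suc j) + ∑[ x < n ] sumPairs (λ i j → w x (suc i) (suc j))
    ≡⟨ sym (∑-distrib-+ (λ x → ∑[ j < k ] w x zero (suc j)) (λ x → sumPairs (λ i j → w x (suc i) (suc j)))) ⟩
  ∑[ x < n ] sumPairs (w x) ∎
  where open ≡-Reasoning

n+nC2≡[1+n]C2 : ∀ c → c + c C 2 ≡ suc c C 2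
n+nC2≡[1+n]C2 c = trans (cong (_+ c C 2) (sym (nC1≡n c))) (nCk+nC[k+1]≡[n+1]C[k+1] c 1)

sumPairs-∧ : ∀ {k} (b : Fin k → Bool) →
  sumPairs (λ i j → bit (b i ∧ b j)) ≡ (∑[ i < k ] bit (b i)) C 2
sumPairs-∧ {zero}  b = refl
sumPairs-∧ {suc k} b with b zero
... | true  = trans (cong (∑[ j < k ] bit (b (suc j)) +_) (sumPairs-∧ (b ∘ suc)))
                    (n+nC2≡[1+n]C2 (∑[ j < k ] bit (b (suc j))))
... | false = cong₂ _+_ (sum-replicate-zero k) (sumPairs-∧ (b ∘ suc))

sumPairs≤kC2 : ∀ {k} (w : Fin k → Fin k → ℕ) → (∀ {i j} → i ≢ j → w i j ≤ 1) → sumPairs w ≤ k C 2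
sumPairs≤kC2 {zero}  w w≤1 = z≤n
sumPairs≤kC2 {suc k} w w≤1 = begin
  ∑[ j < k ] w zero (suc j) + sumPairs (λ i j → w (suc i) (suc j))
    ≤⟨ +-mono-≤ (∑-mono-≤ λ j → w≤1 {zero} {suc j} λ ()) (sumPairs≤kC2 _ λ i≢j → w≤1 (i≢j ∘ Fin.suc-injective)) ⟩
  ∑[ j < k ] 1 + k C 2  ≡⟨ cong (_+ k C 2) (trans (∑-const k 1) (*-identityʳ k)) ⟩
  k + k C 2             ≡⟨ n+nC2≡[1+n]C2 k ⟩
  suc k C 2             ∎
  where open ≤-Reasoning

-- The slack equals (s - l) C 2 computed over ℤ, which is unchanged when l and s both grow by one.
m*n≤[1+m]C2+nC2 : ∀ l s → l * s ≤ suc l C 2 + s C 2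
m*n≤[1+m]C2+nC2 zero    s       = z≤n
m*n≤[1+m]C2+nC2 (suc l) zero    = ≤-trans (≤-reflexive (*-zeroʳ l)) z≤n
m*n≤[1+m]C2+nC2 (suc l) (suc s) = begin
  suc l * suc s
    ≡⟨ solve 2 (λ l s → (con 1 :+ l) :* (con 1 :+ s) := (con 1 :+ l) :+ (s :+ l :* s)) refl l s ⟩
  suc l + (s + l * s)
    ≤⟨ +-monoʳ-≤ (suc l) (+-monoʳ-≤ s (m*n≤[1+m]C2+nC2 l s)) ⟩
  suc l + (s + (suc l C 2 + s C 2))
    ≡⟨ solve 4 (λ a s b c → a :+ (s :+ (b :+ c)) := (a :+ b) :+ (s :+ c)) refl (suc l) s (suc l C 2) (s C 2) ⟩
  (suc l + suc l C 2) + (s + s C 2)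
    ≡⟨ cong₂ _+_ (n+nC2≡[1+n]C2 (suc l)) (n+nC2≡[1+n]C2 s) ⟩
  suc (suc l) C 2 + suc s C 2 ∎
  where open ≤-Reasoning
        open +-*-Solver

bonferroni-bits : ∀ {k} l (u : Bool) (b : Fin k → Bool) → (∀ i → b i ≡ true → u ≡ true) →
  l * ∑[ i < k ] bit (b i) ≤ (suc l C 2) * bit u + sumPairs (λ i j → bit (b i ∧ b j))
bonferroni-bits l true  b _ rewrite *-identityʳ (suc l C 2) | sumPairs-∧ b = m*n≤[1+m]C2+nC2 l _
bonferroni-bits {k} l false b b⇒u = ≤-trans (≤-reflexive l*0≡0) z≤n
  where
  absent : ∀ i → bit (b i) ≡ 0
  absent i with b i | b⇒u i
  ... | true  | b⇒false = case b⇒false refl of λ ()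
  ... | false | _       = refl
  l*0≡0 : l * ∑[ i < k ] bit (b i) ≡ 0
  l*0≡0 = trans (cong (l *_) (trans (sum-cong-≗ absent) (sum-replicate-zero k))) (*-zeroʳ l)

bonferroni : ∀ {k n} l (B : Fin k → Subset n) (U : Subset n) → (∀ i → B i ⊆ U) →
  l * ∑[ i < k ] ∣ B i ∣ ≤ (suc l C 2) * ∣ U ∣ + sumPairs (λ i j → ∣ B i ∩ B j ∣)
bonferroni {k} {n} l B U B⊆U = begin
  l * ∑[ i < k ] ∣ B i ∣
    ≡⟨ cong (l *_) (trans (sum-cong-≗ (∣p∣≡∑ ∘ B)) (∑-comm (λ i x → bit (member x i)))) ⟩
  l * ∑[ x < n ] ∑[ i < k ] bit (member x i)
    ≡⟨ *-distribˡ-sum l (λ x → ∑[ i < k ] bit (member x i)) ⟩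
  ∑[ x < n ] (l * ∑[ i < k ] bit (member x i))
    ≤⟨ ∑-mono-≤ (λ x → bonferroni-bits l (lookup U x) (member x) (covered x)) ⟩
  ∑[ x < n ] (μ * bit (lookup U x) + coincidences x)
    ≡⟨ ∑-distrib-+ (λ x → μ * bit (lookup U x)) coincidences ⟩
  ∑[ x < n ] (μ * bit (lookup U x)) + ∑[ x < n ] coincidences x
    ≡⟨ sym (cong₂ _+_ (trans (cong (μ *_) (∣p∣≡∑ U)) (*-distribˡ-sum μ (λ x → bit (lookup U x))))
                      (trans (sumPairs-cong (λ i j → ∣p∩q∣≡∑ (B i) (B j)))
                             (sumPairs-∑-comm (λ x i j → bit (member x i ∧ member x j))))) ⟩
  μ * ∣ U ∣ + sumPairs (λ i j → ∣ B i ∩ B j ∣) ∎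
  where
  open ≤-Reasoning
  μ = suc l C 2
  member : Fin n → Fin k → Bool
  member x i = lookup (B i) x
  coincidences : Fin n → ℕ
  coincidences x = sumPairs (λ i j → bit (member x i ∧ member x j))
  covered : ∀ x i → member x i ≡ true → lookup U x ≡ true
  covered x i x∈Bi = []=⇒lookup (B⊆U i (lookup⇒[]= x (B i) x∈Bi))

record _↪_ (G H : Graph) : Set where
  field
    embed           : V G → V H
    embed-Adj       : ∀ {u v} → Adj G u v → Adj H (embed u) (embed v)
    embed-injective : ∀ {u v} → embed u ≡ embed v → u ≡ v

WalkSeparated : (G : Graph) {n : ℕ} → (V G → Subset n) → Set
WalkSeparated G f = ∀ {u v k} → u ≢ v → Walk G u v k → ∣ f u ∩ f v ∣ < k

toneColoring⇒walkSeparated : ∀ {G t n} (c : ToneColoring G t n) → WalkSeparated G (proj₁ c)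
toneColoring⇒walkSeparated (_ , _ , far) {k = k} u≢v walk = ≰⇒> λ k≤∣∩∣ → far _ _ u≢v k k≤∣∩∣ walk

walkSeparated⇒toneColoring : ∀ {G t n} (f : V G → Subset n) →
  (∀ v → ∣ f v ∣ ≡ t) → WalkSeparated G f → ToneColoring G t n
walkSeparated⇒toneColoring f ∣f∣≡t sep = f , ∣f∣≡t , λ u v u≢v k k≤∣∩∣ walk → <⇒≱ (sep u≢v walk) k≤∣∩∣

restrict : ∀ {G H t n} → G ↪ H → ToneColoring H t n → ToneColoring G t n
restrict {G} {H} e c@(f , ∣f∣≡t , _) =
  walkSeparated⇒toneColoring (f ∘ embed) (∣f∣≡t ∘ embed)
    λ u≢v walk → toneColoring⇒walkSeparated c (u≢v ∘ embed-injective) (map-walk walk)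
  where
  open _↪_ e
  map-walk : ∀ {u v k} → Walk G u v k → Walk H (embed u) (embed v) k
  map-walk here          = here
  map-walk (step a walk) = step (embed-Adj a) (map-walk walk)

Star↪Star : ∀ k d → Star k ↪ Star (k + d)
Star↪Star k d = record { embed = Maybe.map (_↑ˡ d) ; embed-Adj = embed-Adj ; embed-injective = embed-injective }
  where
  embed-Adj : ∀ {u v} → StarAdj k u v → StarAdj (k + d) (Maybe.map (_↑ˡ d) u) (Maybe.map (_↑ˡ d) v)
  embed-Adj (c-l i) = c-l (i ↑ˡ d)
  embed-Adj (l-c i) = l-c (i ↑ˡ d)
  embed-injective : ∀ {u v} → Maybe.map (_↑ˡ d) u ≡ Maybe.map (_↑ˡ d) v → u ≡ v
  embed-injective {nothing} {nothing} _  = refl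
  embed-injective {just i}  {just j}  eq = cong just (Fin.↑ˡ-injective d i j (just-injective eq))

Star↪Tree : ∀ k → Star k ↪ Tree k
Star↪Tree k = record { embed = Maybe.map (_, []) ; embed-Adj = embed-Adj ; embed-injective = embed-injective }
  where
  embed-Adj : ∀ {u v} → StarAdj k u v → TreeAdj k (Maybe.map (_, []) u) (Maybe.map (_, []) v)
  embed-Adj (c-l i) = root-down i
  embed-Adj (l-c i) = root-up i
  embed-injective : ∀ {u v} → Maybe.map (_, []) u ≡ Maybe.map (_, []) v → u ≡ v
  embed-injective {nothing} {nothing} _    = refl
  embed-injective {just i}  {just i}  refl = refl

Tree↪Tree : ∀ k d → Tree (suc k) ↪ Tree (suc k + d)
Tree↪Tree k d = record { embed = Maybe.map φ ; embed-Adj = embed-Adj ; embed-injective = embed-injective }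
  where
  φ : Fin (suc k) × List (Fin k) → Fin (suc k + d) × List (Fin (k + d))
  φ (i , w) = i ↑ˡ d , List.map (_↑ˡ d) w
  embed-Adj : ∀ {u v} → TreeAdj (suc k) u v → TreeAdj (suc k + d) (Maybe.map φ u) (Maybe.map φ v)
  embed-Adj (root-down i) = root-down (i ↑ˡ d)
  embed-Adj (root-up i)   = root-up (i ↑ˡ d)
  embed-Adj (down i w j)  = down (i ↑ˡ d) (List.map (_↑ˡ d) w) (j ↑ˡ d)
  embed-Adj (up i w j)    = up (i ↑ˡ d) (List.map (_↑ˡ d) w) (j ↑ˡ d)
  embed-injective : ∀ {u v} → Maybe.map φ u ≡ Maybe.map φ v → u ≡ v
  embed-injective {nothing}      {nothing}      _  = refl
  embed-injective {just (i , w)} {just (j , x)} eq with ×-≡,≡←≡ (just-injective eq)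
  ... | i≡j , w≡x = cong₂ (λ i w → just (i , w)) (Fin.↑ˡ-injective d i j i≡j)
                          (List.map-injective (Fin.↑ˡ-injective d _ _) w≡x)

star-bound : ∀ {k t m} l → ToneColoring (Star k) t m → l * (k * t) ≤ (suc l C 2) * (m ∸ t) + k C 2
star-bound {k} {t} {m} l c@(f , ∣f∣≡t , _) = begin
  l * (k * t)
    ≡⟨ cong (l *_) (sym (trans (sum-cong-≗ (∣f∣≡t ∘ just)) (∑-const k t))) ⟩
  l * ∑[ i < k ] ∣ f (just i) ∣
    ≤⟨ bonferroni l (f ∘ just) (∁ (f nothing)) leaf⊆∁centre ⟩
  (suc l C 2) * ∣ ∁ (f nothing) ∣ + sumPairs (λ i j → ∣ f (just i) ∩ f (just j) ∣)
    ≤⟨ +-mono-≤ (≤-reflexive (cong ((suc l C 2) *_) ∣∁centre∣≡m∸t)) (sumPairs≤kC2 _ leaves-meet-once) ⟩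
  (suc l C 2) * (m ∸ t) + k C 2 ∎
  where
  open ≤-Reasoning
  sep = toneColoring⇒walkSeparated c
  leaf⊆∁centre : ∀ i → f (just i) ⊆ ∁ (f nothing)
  leaf⊆∁centre i = ∣p∩q∣≡0⇒q⊆∁p (n<1⇒n≡0 (sep (λ ()) (step (c-l i) here)))
  ∣∁centre∣≡m∸t : ∣ ∁ (f nothing) ∣ ≡ m ∸ t
  ∣∁centre∣≡m∸t = trans (∣∁p∣≡n∸∣p∣ (f nothing)) (cong (m ∸_) (∣f∣≡t nothing))
  leaves-meet-once : ∀ {i j} → i ≢ j → ∣ f (just i) ∩ f (just j) ∣ ≤ 1
  leaves-meet-once i≢j = ≤-pred (sep (i≢j ∘ just-injective) (step (l-c _) (step (c-l _) here)))

star-threshold : ∀ l k t b {m} → (suc l C 2) * (b ∸ t) + k C 2 < l * (k * t) →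
  ToneColoring (Star k) t m → b < m
star-threshold l k t b g[b]<c c =
  ≰⇒> λ m≤b → <⇒≱ g[b]<c (≤-trans (star-bound l c) (+-monoˡ-≤ (k C 2) (*-monoʳ-≤ (suc l C 2) (∸-monoˡ-≤ t m≤b))))

8≤τ₃-Star : ∀ d {m} → ToneColoring (Star (2 + d)) 3 m → 8 ≤ m
8≤τ₃-Star d = star-threshold 1 2 3 7 (≤ᵇ⇒≤ _ _ _) ∘ restrict (Star↪Star 2 d)

9≤τ₃-Star : ∀ d {m} → ToneColoring (Star (3 + d)) 3 m → 9 ≤ m
9≤τ₃-Star d = star-threshold 1 3 3 8 (≤ᵇ⇒≤ _ _ _) ∘ restrict (Star↪Star 3 d)

-- Weight 1 only gives m ≥ 8 for five leaves; weight 2 is what reaches 10.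
10≤τ₃-Star : ∀ d {m} → ToneColoring (Star (5 + d)) 3 m → 10 ≤ m
10≤τ₃-Star d = star-threshold 2 5 3 9 (≤ᵇ⇒≤ _ _ _) ∘ restrict (Star↪Star 5 d)

preimage : ∀ {n} → (Fin n → Fin n) → Subset n → Subset n
preimage g P = tabulate (lookup P ∘ g)

preimage-∘ : ∀ {n} (h g : Fin n → Fin n) (P : Subset n) → preimage (h ∘ g) P ≡ preimage g (preimage h P)
preimage-∘ h g P = tabulate-cong λ x → sym (lookup∘tabulate (lookup P ∘ h) (g x))

preimage-involutive : ∀ {n} {g : Fin n → Fin n} → (∀ x → g (g x) ≡ x) → ∀ P → preimage g (preimage g P) ≡ P
preimage-involutive {g = g} g²≡id P = begin
  preimage g (preimage g P) ≡⟨ preimage-∘ g g P ⟨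
  preimage (g ∘ g) P        ≡⟨ tabulate-cong (cong (lookup P) ∘ g²≡id) ⟩
  tabulate (lookup P)       ≡⟨ tabulate∘lookup P ⟩
  P                         ∎
  where open ≡-Reasoning

preimage-∩ : ∀ {n} (g : Fin n → Fin n) (P Q : Subset n) → preimage g P ∩ preimage g Q ≡ preimage g (P ∩ Q)
preimage-∩ g P Q = trans (sym (tabulate∘lookup _)) (tabulate-cong λ x → begin
  lookup (preimage g P ∩ preimage g Q) x                  ≡⟨ lookup-zipWith _∧_ x (preimage g P) (preimage g Q) ⟩
  lookup (preimage g P) x ∧ lookup (preimage g Q) x       ≡⟨ cong₂ _∧_ (lookup∘tabulate _ x) (lookup∘tabulate _ x) ⟩
  lookup P (g x) ∧ lookup Q (g x)                         ≡⟨ lookup-zipWith _∧_ (g x) P Q ⟨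
  lookup (P ∩ Q) (g x)                                    ∎)
  where open ≡-Reasoning

∣preimage∣ : ∀ {n} (π : Permutation n n) (P : Subset n) → ∣ preimage (π ⟨$⟩ʳ_) P ∣ ≡ ∣ P ∣
∣preimage∣ {n} π P = begin
  ∣ preimage (π ⟨$⟩ʳ_) P ∣                   ≡⟨ ∣p∣≡∑ (preimage (π ⟨$⟩ʳ_) P) ⟩
  ∑[ x < n ] bit (lookup (preimage (π ⟨$⟩ʳ_) P) x) ≡⟨ sum-cong-≗ (λ x → cong bit (lookup∘tabulate (lookup P ∘ (π ⟨$⟩ʳ_)) x)) ⟩
  ∑[ x < n ] bit (lookup P (π ⟨$⟩ʳ x))         ≡⟨ sum-permute (bit ∘ lookup P) π ⟨
  ∑[ y < n ] bit (lookup P y)                  ≡⟨ ∣p∣≡∑ P ⟨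
  ∣ P ∣                                        ∎
  where open ≡-Reasoning

∣preimage∩preimage∣ : ∀ {n} (π : Permutation n n) (P Q : Subset n) →
  ∣ preimage (π ⟨$⟩ʳ_) P ∩ preimage (π ⟨$⟩ʳ_) Q ∣ ≡ ∣ P ∩ Q ∣
∣preimage∩preimage∣ π P Q = trans (cong ∣_∣ (preimage-∩ (π ⟨$⟩ʳ_) P Q)) (∣preimage∣ π (P ∩ Q))

record ToneScheme (n K : ℕ) : Set where
  field
    base            : Subset n
    swap            : Fin K → Fin n → Fin n
    swap-involutive : ∀ m x → swap m (swap m x) ≡ x
    ∣base∣≡3        : ∣ base ∣ ≡ 3
    ∣line∩base∣≡0   : ∀ m → ∣ preimage (swap m) base ∩ base ∣ ≡ 0
    ∣line∩line∣≡1   : ∀ m m′ → m ≢ m′ → ∣ preimage (swap m) base ∩ preimage (swap m′) base ∣ ≡ 1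

TreeAdj-sym : ∀ {k u v} → TreeAdj k u v → TreeAdj k v u
TreeAdj-sym (root-down i) = root-up i
TreeAdj-sym (root-up i)   = root-down i
TreeAdj-sym (down i w j)  = up i w j
TreeAdj-sym (up i w j)    = down i w j

module SchemeColoring {n k} (S : ToneScheme n (suc k)) where
  open ToneScheme S

  line : Fin (suc k) → Subset n
  line m = preimage (swap m) base

  involution : Fin (suc k) → Permutation n n
  involution m = permutation (swap m) (swap m) (swap-involutive m) (swap-involutive m)

  -- The edge from (i , w) up to its parent has slot parentSlot i w; the child j
  -- of (i , w) is reached through the j-th of the remaining k slots.
  parentSlot : Fin (suc k) → List (Fin k) → Fin (suc k)
  parentSlot i []      = i
  parentSlot i (j ∷ w) = punchIn (parentSlot i w) j

  frame : TreeV (suc k) → Permutation n n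
  frame nothing            = Perm.id
  frame (just (i , []))    = frame nothing ∘ₚ involution i
  frame (just (i , j ∷ w)) = frame (just (i , w)) ∘ₚ involution (parentSlot i (j ∷ w))

  colour : TreeV (suc k) → Subset n
  colour v = preimage (frame v ⟨$⟩ʳ_) base

  neighbourColour : TreeV (suc k) → Fin (suc k) → Subset n
  neighbourColour x m = preimage (frame x ⟨$⟩ʳ_) (line m)

  slot : ∀ {u x} → TreeAdj (suc k) u x → Fin (suc k)
  slot (root-down i) = i
  slot (root-up i)   = i
  slot (down i w j)  = parentSlot i (j ∷ w)
  slot (up i w j)    = parentSlot i (j ∷ w)

  child-colour : ∀ x m → preimage ((frame x ∘ₚ involution m) ⟨$⟩ʳ_) base ≡ neighbourColour x m
  child-colour x m = preimage-∘ (swap m) (frame x ⟨$⟩ʳ_) base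

  parent-colour : ∀ x m → colour x ≡ preimage ((frame x ∘ₚ involution m) ⟨$⟩ʳ_) (line m)
  parent-colour x m = sym (begin
    preimage (swap m ∘ (frame x ⟨$⟩ʳ_)) (line m)     ≡⟨ preimage-∘ (swap m) (frame x ⟨$⟩ʳ_) (line m) ⟩
    preimage (frame x ⟨$⟩ʳ_) (preimage (swap m) (line m)) ≡⟨ cong (preimage (frame x ⟨$⟩ʳ_)) (preimage-involutive (swap-involutive m) base) ⟩
    colour x                                         ∎)
    where open ≡-Reasoning

  colour≡neighbourColour : ∀ {u x} (a : TreeAdj (suc k) u x) → colour u ≡ neighbourColour x (slot a)
  colour≡neighbourColour (root-down i) = parent-colour nothing i
  colour≡neighbourColour (root-up i)   = child-colour nothing i
  colour≡neighbourColour (down i w j)  = parent-colour (just (i , w)) (parentSlot i (j ∷ w))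
  colour≡neighbourColour (up i w j)    = child-colour (just (i , w)) (parentSlot i (j ∷ w))

  slot-injective : ∀ {u y x} (a : TreeAdj (suc k) u x) (b : TreeAdj (suc k) y x) → slot a ≡ slot b → u ≡ y
  slot-injective (root-up i)         (root-up .i)          refl = refl
  slot-injective (root-down i)       (root-down .i)        _  = refl
  slot-injective (root-down i)       (up .i .[] j)         eq = ⊥-elim (punchInᵢ≢i i j (sym eq))
  slot-injective (up i .[] j)        (root-down .i)        eq = ⊥-elim (punchInᵢ≢i i j eq)
  slot-injective (up i w j)          (up .i .w j′)         eq with punchIn-injective (parentSlot i w) j j′ eq
  ... | refl = refl
  slot-injective (down i w j)        (down .i .w .j)       _  = refl
  slot-injective (down i w j)        (up .i .(j ∷ w) j′)   eq = ⊥-elim (punchInᵢ≢i _ j′ (sym eq))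
  slot-injective (up i .(j ∷ w) j′)  (down .i w j)         eq = ⊥-elim (punchInᵢ≢i _ j′ eq)

  ∣colour∣≡3 : ∀ v → ∣ colour v ∣ ≡ 3
  ∣colour∣≡3 v = trans (∣preimage∣ (frame v) base) ∣base∣≡3

  adjacent-disjoint : ∀ {u x} → TreeAdj (suc k) u x → ∣ colour u ∩ colour x ∣ ≡ 0
  adjacent-disjoint {u} {x} a = begin
    ∣ colour u ∩ colour x ∣                   ≡⟨ cong (λ c → ∣ c ∩ colour x ∣) (colour≡neighbourColour a) ⟩
    ∣ neighbourColour x (slot a) ∩ colour x ∣ ≡⟨ ∣preimage∩preimage∣ (frame x) (line (slot a)) base ⟩
    ∣ line (slot a) ∩ base ∣                  ≡⟨ ∣line∩base∣≡0 (slot a) ⟩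
    0                                         ∎
    where open ≡-Reasoning

  neighbours-meet-once : ∀ {u y x} → TreeAdj (suc k) u x → TreeAdj (suc k) y x →
    u ≡ y ⊎ ∣ colour u ∩ colour y ∣ ≡ 1
  neighbours-meet-once {u} {y} {x} a b with slot a Fin.≟ slot b
  ... | yes same = inj₁ (slot-injective a b same)
  ... | no  diff = inj₂ (begin
    ∣ colour u ∩ colour y ∣
      ≡⟨ cong₂ (λ p q → ∣ p ∩ q ∣) (colour≡neighbourColour a) (colour≡neighbourColour b) ⟩
    ∣ neighbourColour x (slot a) ∩ neighbourColour x (slot b) ∣
      ≡⟨ ∣preimage∩preimage∣ (frame x) (line (slot a)) (line (slot b)) ⟩
    ∣ line (slot a) ∩ line (slot b) ∣
      ≡⟨ ∣line∩line∣≡1 (slot a) (slot b) diff ⟩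
    1 ∎)
    where open ≡-Reasoning

  walkSeparated : WalkSeparated (Tree (suc k)) colour
  walkSeparated u≢u here = ⊥-elim (u≢u refl)
  walkSeparated _ (step a here) = s≤s (≤-reflexive (adjacent-disjoint a))
  walkSeparated u≢v (step a (step b here)) with neighbours-meet-once a (TreeAdj-sym b)
  ... | inj₁ u≡v   = ⊥-elim (u≢v u≡v)
  ... | inj₂ meet₁ = s≤s (≤-reflexive meet₁)
  walkSeparated {u} {v} _ (step a (step b (step c here))) with neighbours-meet-once a (TreeAdj-sym b)
  ... | inj₁ refl  = ≤-trans (s≤s (≤-reflexive (adjacent-disjoint c))) (s≤s z≤n)
  ... | inj₂ meet₁ = subst₂ (λ s t → s + ∣ colour u ∩ colour v ∣ ≤ t) meet₁
    (cong₂ _+_ (∣colour∣≡3 u) (adjacent-disjoint c)) (∣p∩q∣+∣p∩r∣≤∣p∣+∣q∩r∣ (colour u) _ (colour v))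
  walkSeparated {u} {v} {suc (suc (suc (suc k′)))} _ (step _ (step _ (step _ (step _ _)))) =
    s≤s (≤-trans (∣p∩q∣≤∣p∣ (colour u) (colour v)) (≤-trans (≤-reflexive (∣colour∣≡3 u)) (m≤m+n 3 k′)))

  schemeColoring : ToneColoring (Tree (suc k)) 3 n
  schemeColoring = walkSeparated⇒toneColoring colour ∣colour∣≡3 walkSeparated

module LineScheme {n K} (lines : Vec (Fin (3 + n) × Fin (3 + n) × Fin (3 + n)) K) where

  base : Subset (3 + n)
  base = inside ∷ inside ∷ inside ∷ ⊥

  swap : Fin K → Fin (3 + n) → Fin (3 + n)
  swap m with lookup lines m
  ... | a , b , c = transpose 0F a ∘ transpose 1F b ∘ transpose 2F c

  scheme : {True (all? λ m → all? λ x → swap m (swap m x) Fin.≟ x)} →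
           {True (all? λ m → ∣ preimage (swap m) base ∩ base ∣ ≟ 0)} →
           {True (all? λ m → all? λ m′ →
             ¬? (m Fin.≟ m′) →-dec ∣ preimage (swap m) base ∩ preimage (swap m′) base ∣ ≟ 1)} →
           ToneScheme (3 + n) K
  scheme {involutive} {disjoint} {meet-once} = record
    { base            = base
    ; swap            = swap
    ; swap-involutive = toWitness involutive
    ; ∣base∣≡3        = cong (3 +_) (∣⊥∣≡0 n)
    ; ∣line∩base∣≡0   = toWitness disjoint
    ; ∣line∩line∣≡1   = toWitness meet-once
    }

scheme₂ : ToneScheme 8 2
scheme₂ = LineScheme.scheme ((# 3 , # 4 , # 5) ∷ (# 5 , # 6 , # 7) ∷ [])

-- The lines are the vertex stars of K₄, whose six edges are the colours 3, ..., 8.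
scheme₄ : ToneScheme 9 4
scheme₄ = LineScheme.scheme
  ((# 3 , # 4 , # 5) ∷ (# 3 , # 6 , # 7) ∷ (# 4 , # 6 , # 8) ∷ (# 5 , # 7 , # 8) ∷ [])

-- The lines of the Fano plane on the colours 3, ..., 9.
scheme₇ : ToneScheme 10 7
scheme₇ = LineScheme.scheme
  ((# 3 , # 4 , # 5) ∷ (# 3 , # 6 , # 7) ∷ (# 3 , # 8 , # 9) ∷ (# 4 , # 6 , # 8) ∷
   (# 4 , # 7 , # 9) ∷ (# 5 , # 6 , # 9) ∷ (# 5 , # 7 , # 8) ∷ [])

tree₂ : ToneColoring (Tree 2) 3 8
tree₂ = SchemeColoring.schemeColoring scheme₂

tree₄ : ToneColoring (Tree 4) 3 9
tree₄ = SchemeColoring.schemeColoring scheme₄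

tree₇ : ToneColoring (Tree 7) 3 10
tree₇ = SchemeColoring.schemeColoring scheme₇

toneNumbers-Star-Tree : ∀ {k t n} → ToneColoring (Tree k) t n → (∀ {m} → ToneColoring (Star k) t m → n ≤ m) →
  ToneNumberIs (Star k) t n × ToneNumberIs (Tree k) t n
toneNumbers-Star-Tree {k} coloring lower =
  (restrict (Star↪Tree k) coloring , λ _ → lower) , (coloring , λ _ → lower ∘ restrict (Star↪Tree k))

theorem6p1 : (Δ : ℕ) → 2 ≤ Δ → Δ ≤ 7 →
    (Δ ≡ 2 → ToneNumberIs (Star Δ) 3 8 × ToneNumberIs (Tree Δ) 3 8) ×
    (3 ≤ Δ → Δ ≤ 4 → ToneNumberIs (Star Δ) 3 9 × ToneNumberIs (Tree Δ) 3 9) ×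
    (5 ≤ Δ → ToneNumberIs (Star Δ) 3 10 × ToneNumberIs (Tree Δ) 3 10)
theorem6p1 0 () _
theorem6p1 1 (s≤s ()) _
theorem6p1 2 _ _ = (λ _ → toneNumbers-Star-Tree tree₂ (8≤τ₃-Star 0)) , ⊥-elim ∘ ≤⇒≤ᵇ , ⊥-elim ∘ ≤⇒≤ᵇ
theorem6p1 3 _ _ = (λ ()) , (λ _ _ → toneNumbers-Star-Tree (restrict (Tree↪Tree 2 1) tree₄) (9≤τ₃-Star 0)) , ⊥-elim ∘ ≤⇒≤ᵇ
theorem6p1 4 _ _ = (λ ()) , (λ _ _ → toneNumbers-Star-Tree tree₄ (9≤τ₃-Star 1)) , ⊥-elim ∘ ≤⇒≤ᵇ
theorem6p1 5 _ _ = (λ ()) , (λ _ → ⊥-elim ∘ ≤⇒≤ᵇ) , (λ _ → toneNumbers-Star-Tree (restrict (Tree↪Tree 4 2) tree₇) (10≤τ₃-Star 0))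
theorem6p1 6 _ _ = (λ ()) , (λ _ → ⊥-elim ∘ ≤⇒≤ᵇ) , (λ _ → toneNumbers-Star-Tree (restrict (Tree↪Tree 5 1) tree₇) (10≤τ₃-Star 1))
theorem6p1 7 _ _ = (λ ()) , (λ _ → ⊥-elim ∘ ≤⇒≤ᵇ) , (λ _ → toneNumbers-Star-Tree tree₇ (10≤τ₃-Star 2))
theorem6p1 (suc (suc (suc (suc (suc (suc (suc (suc _)))))))) _ (s≤s (s≤s (s≤s (s≤s (s≤s (s≤s (s≤s ())))))))
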